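{- Let $H$ be a gated subgraph of a median graph $G$ of dimension $d$. Then for every $x\in V(H)$, the total boundary $\partial^*F(x)$ of the fiber $F(x)$ of $H$ does not contain $d$-dimensional cubes.
   Context: $d_G$ is the shortest-path distance, $I(u,v)=\{w: d_G(u,w)+d_G(w,v)=d_G(u,v)\}$. $G$ is median if $I(x,y)\cap I(y,z)\cap I(z,x)$ is a single vertex for all $x,y,z$; its dimension is the largest $d$ such that $G$ contains the hypercube $Q_d$ as a subgraph. A subgraph $H$ is gated if every vertex $v$ has a vertex $v'\in V(H)$ (its gate) with $d_G(v,u)=d_G(v,v')+d_G(v',u)$ for all $u\in V(H)$; the fiber $F(x)$ of $x\in V(H)$ is the set of vertices with gate $x$. Fibers $F(x),F(y)$ are neighboring if some edge joins them; then $\partial_yF(x)$ is the subgraph of $G$ induced by the vertices of $F(x)$ having a neighbor in $F(y)$. The total boundary $\partial^*F(x)$ is the subgraph whose vertex set and edge set are the unions of the vertex sets and edge sets of all $\partial_yF(x)$ over all fibers $F(y)$ neighboring $F(x)$, $y\in V(H)$. -}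

module Defs where

open import Data.Nat using (ℕ; zero; suc; _+_; _≤_)
open import Data.Bool using (Bool; not)
open import Data.Fin using (Fin)
open import Data.Vec using (Vec; _[_]%=_)
open import Data.Product using (Σ; ∃; _×_; _,_)
open import Relation.Binary.PropositionalEquality using (_≡_; _≢_)
open import Relation.Nullary using (¬_)

record Graph : Set₁ where
  field
    V     : Set
    _~_   : V → V → Set
    ~-sym : ∀ {u v} → u ~ v → v ~ u
    ~-irr : ∀ {u} → ¬ (u ~ u)

module _ (G : Graph) where
  open Graph G

  data Walk : V → V → ℕ → Set where
    nil  : ∀ {u} → Walk u u zero
    cons : ∀ {u w v n} → u ~ w → Walk w v n → Walk u v (suc n)

  Dist : V → V → ℕ → Set
  Dist u v n = Walk u v n × (∀ m → Walk u v m → n ≤ m)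

  Connected : Set
  Connected = ∀ u v → ∃ λ n → Dist u v n

  InInterval : V → V → V → Set
  InInterval u v w =
    ∀ a b c → Dist u w a → Dist w v b → Dist u v c → a + b ≡ c

  -- G is median: connected (so d_G is defined) and I(x,y) ∩ I(y,z) ∩ I(z,x)
  -- consists of exactly one vertex for all x, y, z.
  IsMedian : Set
  IsMedian = Connected ×
    (∀ x y z → Σ V λ m →
       (InInterval x y m × InInterval y z m × InInterval z x m) ×
       (∀ m' → InInterval x y m' × InInterval y z m' × InInterval z x m' → m' ≡ m))

  QAdj : ∀ {d} → Vec Bool d → Vec Bool d → Set
  QAdj {d} a b = Σ (Fin d) λ i → b ≡ a [ i ]%= not

  ContainsCubeIn : (P : V → Set) (R : V → V → Set) (d : ℕ) → Set
  ContainsCubeIn P R d = Σ (Vec Bool d → V) λ f →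
    (∀ a b → f a ≡ f b → a ≡ b) ×
    (∀ a → P (f a)) ×
    (∀ a b → QAdj a b → R (f a) (f b))

  ContainsCube : ℕ → Set
  ContainsCube d = ContainsCubeIn (λ _ → Data.Unit.⊤) _~_ d
    where import Data.Unit

  HasDimension : ℕ → Set
  HasDimension d = ContainsCube d × (∀ k → ContainsCube k → k ≤ d)

  IsGate : (H : V → Set) → V → V → Set
  IsGate H v v' = H v' ×
    (∀ u → H u → ∀ a b c → Dist v u a → Dist v v' b → Dist v' u c → a ≡ b + c)

  IsGated : (V → Set) → Set
  IsGated H = ∀ v → Σ V λ v' → IsGate H v v'

  Fiber : (V → Set) → V → V → Set
  Fiber H x v = IsGate H v x

  Neighboring : (V → Set) → V → V → Set
  Neighboring H x y = x ≢ y × (Σ V λ u → Σ V λ w → Fiber H x u × Fiber H y w × u ~ w)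

  BdV : (V → Set) → V → V → V → Set
  BdV H x y v = Fiber H x v × (Σ V λ w → Fiber H y w × v ~ w)

  -- ∂_y F(x) is induced: an edge of G between two of its vertices
  BdE : (V → Set) → V → V → V → V → Set
  BdE H x y u v = BdV H x y u × BdV H x y v × u ~ v

  TotBdV : (V → Set) → V → V → Set
  TotBdV H x v = Σ V λ y → H y × Neighboring H x y × BdV H x y v

  TotBdE : (V → Set) → V → V → V → Set
  TotBdE H x u v = Σ V λ y → H y × Neighboring H x y × BdE H x y u v

-- Let f be a k-cube in ∂*F(x).  Measured from x, the levels d(f a, x)
-- change by one along every cube edge (median graphs are bipartite in this strong
-- sense), and a square never has two opposite corners above two distinct others
-- (both lower corners would be the median of the upper ones with x).  Hence every
-- coordinate has a fixed rising direction, the cube has an apex t = f top, and the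
-- whole cube lies on geodesics from t to x.  Being in ∂*F(x), t has a neighbour w in
-- a fiber F(y), y ≠ x, and t ~ w turns out to be parallel to the edge x ~ y.
-- Lifting u ↦ median(u, w, y) moves every vertex of I(t,x) to a neighbour off
-- I(t,x), injectively and preserving edges, so the cube and its lift form a
-- (k+1)-cube (a prism).  For k = d this contradicts the dimension of G.

module Submission where

open import Defs
open import Data.Nat using (ℕ; zero; suc; _+_; _≤_; _<ᵇ_; z≤n; s≤s)
open import Data.Nat.Properties
open import Data.Bool using (Bool; true; false; not; T)
open import Data.Bool.Properties using (not-involutive; not-¬)
open import Data.Fin using (Fin; zero; suc)
open import Data.Fin.Properties using () renaming (_≟_ to _≟ᶠ_)
open import Data.Vec using (Vec; []; _∷_; _[_]%=_; _[_]≔_; lookup; tabulate; replicate)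
open import Data.Vec.Properties using (updateAt-updateAt; updateAt-id-local; updateAt-commutes; lookup∘updateAt; lookup∘tabulate)
open import Data.Product using (Σ; _×_; _,_; proj₁; proj₂)
open import Data.Sum using (_⊎_; inj₁; inj₂)
open import Data.Unit using (tt)
open import Data.Empty using (⊥; ⊥-elim)
open import Function using (_∘_)
open import Relation.Binary.PropositionalEquality
open import Relation.Nullary using (¬_; yes; no)
open import Data.Nat.Tactic.RingSolver using (solve-∀)

open ≡-Reasoning

_⟷_ : ∀ {k} → Vec Bool k → Vec Bool k → Set
_⟷_ {k} a b = Σ (Fin k) λ i → b ≡ a [ i ]%= not

⟷-sym : ∀ {k} {a b : Vec Bool k} → a ⟷ b → b ⟷ a
⟷-sym {a = a} (i , refl) =
  i , sym (trans (updateAt-updateAt i a) (updateAt-id-local i a (not-involutive _)))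

∷-⟷ : ∀ {k} c {a b : Vec Bool k} → a ⟷ b → (c ∷ a) ⟷ (c ∷ b)
∷-⟷ c (i , refl) = suc i , refl

set-⟷ : ∀ {k} (i : Fin k) (a : Vec Bool k) c → (a [ i ]≔ c) ⟷ (a [ i ]≔ not c)
set-⟷ i a c = i , sym (updateAt-updateAt i a)

rung : ∀ {k} {i j : Fin k} → i ≢ j → (a : Vec Bool k) → ∀ c → (a [ i ]≔ c) ⟷ ((a [ j ]%= not) [ i ]≔ c)
rung {j = j} i≢j a c = j , updateAt-commutes _ j i≢j a

set-≢ : ∀ {k} (i : Fin k) (a a' : Vec Bool k) c → (a [ i ]≔ c) ≢ (a' [ i ]≔ not c)
set-≢ i a a' c eq = not-¬ refl
  (trans (sym (lookup∘updateAt i a)) (trans (cong (λ v → lookup v i) eq) (lookup∘updateAt i a')))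

δ : Bool → Bool → ℕ
δ false false = 0
δ true  true  = 0
δ _     _     = 1

hamming : ∀ {k} → Vec Bool k → Vec Bool k → ℕ
hamming []      []      = 0
hamming (x ∷ a) (y ∷ b) = δ x y + hamming a b

flip-invariant⇒constant : ∀ {k} {A : Set} (ψ : Vec Bool k → A) →
  (∀ a j → ψ (a [ j ]%= not) ≡ ψ a) → ∀ a b → ψ a ≡ ψ b
flip-invariant⇒constant {zero}  ψ inv [] [] = refl
flip-invariant⇒constant {suc k} ψ inv (x ∷ a) (y ∷ b) =
  trans (first-bit x y) (flip-invariant⇒constant (ψ ∘ (y ∷_)) (λ a j → inv (y ∷ a) (suc j)) a b)
  where
  first-bit : ∀ x y → ψ (x ∷ a) ≡ ψ (y ∷ a)
  first-bit false false = refl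
  first-bit true  true  = refl
  first-bit false true  = sym (inv (false ∷ a) zero)
  first-bit true  false = sym (inv (true ∷ a) zero)

linear-levels : ∀ {k} (φ : Vec Bool k → ℕ) (s : Vec Bool k) →
  (∀ i a → φ (a [ i ]≔ lookup s i) ≡ suc (φ (a [ i ]≔ not (lookup s i)))) →
  ∀ a → φ a + hamming a s ≡ φ s
linear-levels {zero}  φ []      rises []      = +-identityʳ (φ [])
linear-levels {suc k} φ (c ∷ s) rises (x ∷ a) = begin
  φ (x ∷ a) + (δ x c + hamming a s)   ≡⟨ sym (+-assoc (φ (x ∷ a)) (δ x c) (hamming a s)) ⟩
  φ (x ∷ a) + δ x c + hamming a s     ≡⟨ cong (_+ hamming a s) (first-bit x c (rises zero (x ∷ a))) ⟩
  φ (c ∷ a) + hamming a s             ≡⟨ linear-levels (φ ∘ (c ∷_)) s (λ i a → rises (suc i) (c ∷ a)) a ⟩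
  φ (c ∷ s)                           ∎
  where
  first-bit : ∀ x c → φ (c ∷ a) ≡ suc (φ (not c ∷ a)) → φ (x ∷ a) + δ x c ≡ φ (c ∷ a)
  first-bit false false _  = +-identityʳ _
  first-bit true  true  _  = +-identityʳ _
  first-bit false true  up = trans (+-comm _ 1) (sym up)
  first-bit true  false up = trans (+-comm _ 1) (sym up)

-- A graded function on Q_k (changing by exactly one along every edge) in which no
-- square has a saddle shape (two opposite corners one level above two distinct
-- others) is linear: it has an apex `top` from which it falls off by Hamming distance.
module GradedCube {k} (φ : Vec Bool k → ℕ)
  (graded : ∀ a b → a ⟷ b → φ b ≡ suc (φ a) ⊎ φ a ≡ suc (φ b))
  (no-saddle : ∀ {p q r s n} → p ⟷ r → q ⟷ r → p ⟷ s → q ⟷ s → p ≢ q →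
     φ p ≡ suc n → φ q ≡ suc n → φ r ≡ n → φ s ≡ n → r ≡ s) where

  rises : Fin k → Vec Bool k → Bool
  rises i a = φ (a [ i ]≔ false) <ᵇ φ (a [ i ]≔ true)

  rise : ∀ i a → φ (a [ i ]≔ rises i a) ≡ suc (φ (a [ i ]≔ not (rises i a)))
  rise i a with rises i a in r | graded (a [ i ]≔ false) (a [ i ]≔ true) (set-⟷ i a false)
  ... | true  | inj₁ up   = up
  ... | true  | inj₂ down = ⊥-elim (<-asym (<ᵇ⇒< _ _ (subst T (sym r) tt)) (≤-reflexive (sym down)))
  ... | false | inj₁ up   = ⊥-elim (subst T r (<⇒<ᵇ (≤-reflexive (sym up))))
  ... | false | inj₂ down = down

  no-double-step : ∀ {a b} → a ⟷ b → φ b ≡ suc (suc (suc (φ a))) → ⊥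
  no-double-step {a} {b} e b≡a+3 with graded a b e
  ... | inj₁ b≡a+1 = m≢1+n+m (φ a) {1} (suc-injective (trans (sym b≡a+1) b≡a+3))
  ... | inj₂ a≡b+1 = m≢1+n+m (φ a) {3} (trans a≡b+1 (cong suc b≡a+3))

  -- Parallel edges of a square are oriented alike: otherwise the square would be a saddle.
  rises-flip : ∀ i a j → rises i (a [ j ]%= not) ≡ rises i a
  rises-flip i a j with i ≟ᶠ j
  ... | yes refl = cong₂ (λ u v → φ u <ᵇ φ v) (updateAt-updateAt i a) (updateAt-updateAt i a)
  ... | no i≢j = agree (rises i a) (rises i a') (rise i a) (rise i a')
    where
    a' : Vec Bool k
    a' = a [ j ]%= not

    opposite : ∀ b → φ (a [ i ]≔ b) ≡ suc (φ (a [ i ]≔ not b)) →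
      φ (a' [ i ]≔ not b) ≡ suc (φ (a' [ i ]≔ b)) → ⊥
    opposite b up down with graded (a [ i ]≔ b) (a' [ i ]≔ b) (rung i≢j a b)
    ... | inj₁ higher = no-double-step (rung i≢j a (not b))
          (trans down (cong suc (trans higher (cong suc up))))
    ... | inj₂ lower = set-≢ i a' a b (sym (no-saddle
          (set-⟷ i a b) (⟷-sym (rung i≢j a (not b))) (rung i≢j a b) (⟷-sym (set-⟷ i a' b))
          (set-≢ i a a' b) up (trans down (cong suc level)) refl level))
      where
      level : φ (a' [ i ]≔ b) ≡ φ (a [ i ]≔ not b)
      level = suc-injective (trans (sym lower) up)

    agree : ∀ b b' → φ (a [ i ]≔ b) ≡ suc (φ (a [ i ]≔ not b)) →
      φ (a' [ i ]≔ b') ≡ suc (φ (a' [ i ]≔ not b')) → b' ≡ b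
    agree true  true  _  _    = refl
    agree false false _  _    = refl
    agree true  false up down = ⊥-elim (opposite true up down)
    agree false true  up down = ⊥-elim (opposite false up down)

  -- The apex: each coordinate set to its (globally constant) rising direction.
  top : Vec Bool k
  top = tabulate (λ i → rises i (replicate k false))

  top-rises : ∀ i a → lookup top i ≡ rises i a
  top-rises i a = trans (lookup∘tabulate _ i)
    (flip-invariant⇒constant (rises i) (rises-flip i) (replicate k false) a)

  below-top : ∀ a → φ a + hamming a top ≡ φ top
  below-top = linear-levels φ top λ i a →
    subst (λ c → φ (a [ i ]≔ c) ≡ suc (φ (a [ i ]≔ not c))) (sym (top-rises i a)) (rise i a)

parallel-arith : ∀ D W e → D + e ≤ suc W → W + e ≤ suc D → e ≢ 0 → e ≡ 1 × W ≡ D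
parallel-arith D W zero    _  _  e≢0 = ⊥-elim (e≢0 refl)
parallel-arith D W (suc e) h₁ h₂ _   = cong suc e≡0 , ≤-antisym W≤D D≤W
  where
  D+e≤W : D + e ≤ W
  D+e≤W = ≤-pred (subst (_≤ suc W) (+-suc D e) h₁)
  W+e≤D : W + e ≤ D
  W+e≤D = ≤-pred (subst (_≤ suc D) (+-suc W e) h₂)
  D≤W : D ≤ W
  D≤W = ≤-trans (m≤m+n D e) D+e≤W
  W≤D : W ≤ D
  W≤D = ≤-trans (m≤m+n W e) W+e≤D
  e≡0 : e ≡ 0
  e≡0 = n≤0⇒n≡0 (+-cancelˡ-≤ D e 0
    (subst (D + e ≤_) (sym (+-identityʳ D)) (≤-trans D+e≤W (≤-trans (m≤m+n W e) W+e≤D))))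

regroup : ∀ α β γ → (β + γ) + (α + α) ≡ (α + β) + (γ + α)
regroup = solve-∀

-- The distances α = d(u,m), β = d(m,w), γ = d(m,y) from a median m of u, w, y,
-- given d(u,w) = p+1, d(w,y) = p+q, d(y,u) = q+1, are forced: m is a neighbour of u.
three-distances : ∀ {α β γ p q} → α + β ≡ suc p → β + γ ≡ p + q → γ + α ≡ suc q →
  α ≡ 1 × β ≡ p × γ ≡ q
three-distances {zero} {β} {γ} {p} {q} refl β+γ γ+α =
  ⊥-elim (m≢1+n+m (p + q) {1} (trans (sym β+γ) (trans (cong (suc p +_) γ≡1+q) (cong suc (+-suc p q)))))
  where
  γ≡1+q : γ ≡ suc q
  γ≡1+q = trans (sym (+-identityʳ γ)) γ+α
three-distances {suc α} {β} {γ} {p} {q} α+β β+γ γ+α = cong suc α≡0 , β≡p , γ≡q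
  where
  α+β≡p : α + β ≡ p
  α+β≡p = suc-injective α+β
  γ+α≡q : γ + α ≡ q
  γ+α≡q = suc-injective (trans (sym (+-suc γ α)) γ+α)
  doubled : (β + γ) + (α + α) ≡ (β + γ) + 0
  doubled = begin
    (β + γ) + (α + α)   ≡⟨ regroup α β γ ⟩
    (α + β) + (γ + α)   ≡⟨ cong₂ _+_ α+β≡p γ+α≡q ⟩
    p + q               ≡⟨ sym β+γ ⟩
    β + γ               ≡⟨ sym (+-identityʳ _) ⟩
    (β + γ) + 0         ∎
  α≡0 : α ≡ 0
  α≡0 = m+n≡0⇒m≡0 α (+-cancelˡ-≡ (β + γ) _ _ doubled)
  β≡p : β ≡ p
  β≡p = trans (cong (_+ β) (sym α≡0)) α+β≡p
  γ≡q : γ ≡ q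
  γ≡q = trans (sym (trans (cong (γ +_) α≡0) (+-identityʳ γ))) γ+α≡q

-- Likewise for a median of v, m, w with d(v,m) = 2 and d(m,w) = d(w,v) = L:
-- it is a common neighbour of v and m.
two-distances : ∀ {α β γ L} → α + β ≡ 2 → β + γ ≡ L → γ + α ≡ L → α ≡ 1 × β ≡ 1
two-distances {α} {β} {γ} α+β β+γ γ+α = α≡1 , trans β≡α α≡1
  where
  β≡α : β ≡ α
  β≡α = +-cancelˡ-≡ γ _ _ (trans (+-comm γ β) (trans β+γ (sym γ+α)))
  half : ∀ n → n + n ≡ 2 → n ≡ 1
  half zero          ()
  half (suc zero)    _  = refl
  half (suc (suc n)) eq = ⊥-elim (m+1+n≢0 n (suc-injective (suc-injective eq)))
  α≡1 : α ≡ 1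
  α≡1 = half α (trans (cong (α +_) (sym β≡α)) α+β)

-- The shortest-path metric of a connected graph, intervals, and gates.
module Metric (G : Graph) (conn : Connected G) where
  open Graph G

  d : V → V → ℕ
  d u v = proj₁ (conn u v)

  d-Dist : ∀ u v → Dist G u v (d u v)
  d-Dist u v = proj₂ (conn u v)

  d-walk : ∀ u v → Walk G u v (d u v)
  d-walk u v = proj₁ (d-Dist u v)

  d-min : ∀ {u v n} → Walk G u v n → d u v ≤ n
  d-min {u} {v} p = proj₂ (proj₂ (conn u v)) _ p

  Dist⇒≡d : ∀ {u v n} → Dist G u v n → n ≡ d u v
  Dist⇒≡d (p , minimal) = ≤-antisym (minimal _ (d-walk _ _)) (d-min p)

  _++_ : ∀ {u v w m n} → Walk G u v m → Walk G v w n → Walk G u w (m + n)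
  nil      ++ q = q
  cons e p ++ q = cons e (p ++ q)

  snoc : ∀ {u v w n} → Walk G u v n → v ~ w → Walk G u w (suc n)
  snoc nil        e = cons e nil
  snoc (cons e p) f = cons e (snoc p f)

  reverse : ∀ {u v n} → Walk G u v n → Walk G v u n
  reverse nil        = nil
  reverse (cons e p) = snoc (reverse p) (~-sym e)

  d-sym : ∀ u v → d u v ≡ d v u
  d-sym u v = ≤-antisym (d-min (reverse (d-walk v u))) (d-min (reverse (d-walk u v)))

  d-triangle : ∀ u v w → d u w ≤ d u v + d v w
  d-triangle u v w = d-min (d-walk u v ++ d-walk v w)

  d≡0⇒≡ : ∀ {u v} → d u v ≡ 0 → u ≡ v
  d≡0⇒≡ {u} {v} eq with d u v | d-walk u v
  d≡0⇒≡ refl | .0 | nil = refl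

  d≡1⇒~ : ∀ {u v} → d u v ≡ 1 → u ~ v
  d≡1⇒~ {u} {v} eq with d u v | d-walk u v
  d≡1⇒~ refl | .1 | cons e nil = e

  ~⇒d≡1 : ∀ {u v} → u ~ v → d u v ≡ 1
  ~⇒d≡1 {u} e = ≤-antisym (d-min (cons e nil))
    (n≢0⇒n>0 (λ d≡0 → ~-irr (subst (u ~_) (sym (d≡0⇒≡ d≡0)) e)))

  d-≤-via : ∀ {a b c m n} → d a b ≡ m → d b c ≡ n → d a c ≤ m + n
  d-≤-via {a} {b} {c} refl refl = d-triangle a b c

  d-≥-via₁ : ∀ {a b c m n} → d a c ≡ m + n → d b c ≡ n → m ≤ d a b
  d-≥-via₁ {a} {b} {c} {m} {n} ac bc =
    +-cancelʳ-≤ n m (d a b) (subst₂ _≤_ ac (cong (d a b +_) bc) (d-triangle a b c))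

  d-≥-via₂ : ∀ {a b c m n} → d a c ≡ m + n → d a b ≡ m → n ≤ d b c
  d-≥-via₂ {a} {b} {c} {m} {n} ac ab =
    +-cancelˡ-≤ m n (d b c) (subst₂ _≤_ ac (cong (_+ d b c) ab) (d-triangle a b c))

  Between : V → V → V → Set
  Between u w v = d u w + d w v ≡ d u v

  InInterval⇒Between : ∀ {u v w} → InInterval G u v w → Between u w v
  InInterval⇒Between {u} {v} {w} I = I _ _ _ (d-Dist u w) (d-Dist w v) (d-Dist u v)

  Between⇒InInterval : ∀ {u v w} → Between u w v → InInterval G u v w
  Between⇒InInterval {u} {v} {w} btw a b c Da Db Dc rewrite Dist⇒≡d Da | Dist⇒≡d Db | Dist⇒≡d Dc = btw

  cube-walk : ∀ {k} (f : Vec Bool k → V) → (∀ a b → a ⟷ b → f a ~ f b) →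
    ∀ a b → Walk G (f a) (f b) (hamming a b)
  cube-walk {zero}  f edge [] [] = nil
  cube-walk {suc k} f edge (x ∷ a) (y ∷ b) =
    first-bit x y ++ cube-walk (f ∘ (y ∷_)) (λ a b e → edge _ _ (∷-⟷ y e)) a b
    where
    first-bit : ∀ x y → Walk G (f (x ∷ a)) (f (y ∷ a)) (δ x y)
    first-bit false false = nil
    first-bit true  true  = nil
    first-bit false true  = cons (edge _ _ (zero , refl)) nil
    first-bit true  false = cons (edge _ _ (zero , refl)) nil

  gate-split : ∀ {H v g u} → IsGate G H v g → H u → d v u ≡ d v g + d g u
  gate-split {v = v} {g} {u} (_ , split) Hu = split u Hu _ _ _ (d-Dist v u) (d-Dist v g) (d-Dist g u)

  -- The pair (t, w) sits parallel to the edge x ~ y, with t on the side of x.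
  Parallel : V → V → V → V → Set
  Parallel x y t w = d x y ≡ 1 × d w y ≡ d t x × d w x ≡ suc (d t x) × d t y ≡ suc (d t x)

  fiber-edge : ∀ {H x y t w} → H x → H y → x ≢ y → Fiber G H x t → Fiber G H y w → t ~ w →
    Parallel x y t w
  fiber-edge {x = x} {y} {t} {w} Hx Hy x≢y t∈Fx w∈Fy t~w = xy , wy , wx , ty
    where
    t-y : d t y ≡ d t x + d x y
    t-y = gate-split t∈Fx Hy
    w-x : d w x ≡ d w y + d x y
    w-x = trans (gate-split w∈Fy Hx) (cong (d w y +_) (d-sym y x))
    arith : d x y ≡ 1 × d w y ≡ d t x
    arith = parallel-arith (d t x) (d w y) (d x y)
      (subst (_≤ suc (d w y)) t-y (d-≤-via (~⇒d≡1 t~w) refl))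
      (subst (_≤ suc (d t x)) w-x (d-≤-via (~⇒d≡1 (~-sym t~w)) refl))
      (λ xy≡0 → x≢y (d≡0⇒≡ xy≡0))
    xy : d x y ≡ 1
    xy = proj₁ arith
    wy : d w y ≡ d t x
    wy = proj₂ arith
    wx : d w x ≡ suc (d t x)
    wx = trans w-x (trans (cong₂ _+_ wy xy) (+-comm (d t x) 1))
    ty : d t y ≡ suc (d t x)
    ty = trans t-y (trans (cong (d t x +_) xy) (+-comm (d t x) 1))

module _ (G : Graph) where
  open Graph G

  prism : ∀ {k} (f : Vec Bool k → V) (M : V → V) →
    (∀ a b → f a ≡ f b → a ≡ b) → (∀ a b → M (f a) ≡ M (f b) → a ≡ b) → (∀ a b → M (f a) ≢ f b) →
    (∀ a b → a ⟷ b → f a ~ f b) → (∀ a b → a ⟷ b → M (f a) ~ M (f b)) → (∀ a → f a ~ M (f a)) →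
    ContainsCube G (suc k)
  prism {k} f M f-inj Mf-inj disjoint f-edge Mf-edge matching = g , g-inj , (λ _ → tt) , g-edge
    where
    g : Vec Bool (suc k) → V
    g (false ∷ a) = f a
    g (true  ∷ a) = M (f a)

    g-inj : ∀ a b → g a ≡ g b → a ≡ b
    g-inj (false ∷ a) (false ∷ b) eq = cong (false ∷_) (f-inj a b eq)
    g-inj (true  ∷ a) (true  ∷ b) eq = cong (true ∷_) (Mf-inj a b eq)
    g-inj (true  ∷ a) (false ∷ b) eq = ⊥-elim (disjoint a b eq)
    g-inj (false ∷ a) (true  ∷ b) eq = ⊥-elim (disjoint b a (sym eq))

    g-edge : ∀ a b → a ⟷ b → g a ~ g b
    g-edge (false ∷ a) _ (zero  , refl) = matching a
    g-edge (true  ∷ a) _ (zero  , refl) = ~-sym (matching a)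
    g-edge (false ∷ a) _ (suc i , refl) = f-edge a _ (i , refl)
    g-edge (true  ∷ a) _ (suc i , refl) = Mf-edge a _ (i , refl)

-- Median graphs: the median operation, levels, saddle squares and lifting.
module MedianGraph (G : Graph) (med : IsMedian G) where
  open Graph G
  open Metric G (proj₁ med) public

  median : V → V → V → V
  median x y z = proj₁ (proj₂ med x y z)

  median-between₁ : ∀ x y z → Between x (median x y z) y
  median-between₁ x y z = InInterval⇒Between (proj₁ (proj₁ (proj₂ (proj₂ med x y z))))

  median-between₂ : ∀ x y z → Between y (median x y z) z
  median-between₂ x y z = InInterval⇒Between (proj₁ (proj₂ (proj₁ (proj₂ (proj₂ med x y z)))))

  median-between₃ : ∀ x y z → Between z (median x y z) x
  median-between₃ x y z = InInterval⇒Between (proj₂ (proj₂ (proj₁ (proj₂ (proj₂ med x y z)))))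

  median-unique : ∀ {x y z m} → Between x m y → Between y m z → Between z m x → m ≡ median x y z
  median-unique {x} {y} {z} {m} xy yz zx =
    proj₂ (proj₂ (proj₂ med x y z)) m (Between⇒InInterval xy , Between⇒InInterval yz , Between⇒InInterval zx)

  -- Along an edge u ~ v the distance to any vertex x changes by exactly one:
  -- the median of u, v, x is u or v.
  edge-level : ∀ {u v} x → u ~ v → d v x ≡ suc (d u x) ⊎ d u x ≡ suc (d v x)
  edge-level {u} {v} x e
    with median u v x | median-between₁ u v x | median-between₂ u v x | median-between₃ u v x
  ... | m | um+mv | vm+mx | xm+mu with d u m in um
  ... | zero = inj₁ (begin
          d v x           ≡⟨ sym vm+mx ⟩
          d v m + d m x   ≡⟨ cong (λ w → d v w + d w x) (sym u≡m) ⟩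
          d v u + d u x   ≡⟨ cong (_+ d u x) (~⇒d≡1 (~-sym e)) ⟩
          suc (d u x)     ∎)
    where
    u≡m : u ≡ m
    u≡m = d≡0⇒≡ um
  ... | suc k = inj₂ (begin
          d u x           ≡⟨ d-sym u x ⟩
          d x u           ≡⟨ sym xm+mu ⟩
          d x m + d m u   ≡⟨ cong (λ w → d x w + d w u) m≡v ⟩
          d x v + d v u   ≡⟨ cong₂ _+_ (d-sym x v) (~⇒d≡1 (~-sym e)) ⟩
          d v x + 1       ≡⟨ +-comm (d v x) 1 ⟩
          suc (d v x)     ∎)
    where
    m≡v : m ≡ v
    m≡v = d≡0⇒≡ (m+n≡0⇒n≡0 k (suc-injective (trans um+mv (~⇒d≡1 e))))

  -- A square whose two opposite corners p, q lie one level above the other two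
  -- corners r, s (levels measured from x) degenerates: both r and s are the median of p, q, x.
  saddle-collapse : ∀ {p q r s n} x → p ~ r → q ~ r → p ~ s → q ~ s → p ≢ q →
    d p x ≡ suc n → d q x ≡ suc n → d r x ≡ n → d s x ≡ n → r ≡ s
  saddle-collapse {p} {q} {r} {s} {n} x pr qr ps qs p≢q px qx rx sx =
    trans (lower-is-median pr qr rx) (sym (lower-is-median ps qs sx))
    where
    p≁q : ¬ p ~ q
    p≁q e with edge-level x e
    ... | inj₁ q-up = 1+n≢n (sym (trans (trans px (sym qx)) q-up))
    ... | inj₂ p-up = 1+n≢n (sym (trans (trans qx (sym px)) p-up))

    dpq≡2 : d p q ≡ 2
    dpq≡2 = ≤-antisym (d-≤-via (~⇒d≡1 pr) (~⇒d≡1 (~-sym qr))) (at-least-two (d p q) refl)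
      where
      at-least-two : ∀ k → d p q ≡ k → 2 ≤ k
      at-least-two zero          k≡0 = ⊥-elim (p≢q (d≡0⇒≡ k≡0))
      at-least-two (suc zero)    k≡1 = ⊥-elim (p≁q (d≡1⇒~ k≡1))
      at-least-two (suc (suc k)) _   = s≤s (s≤s z≤n)

    lower-is-median : ∀ {t} → p ~ t → q ~ t → d t x ≡ n → t ≡ median p q x
    lower-is-median {t} pt qt tx = median-unique
      (trans (cong₂ _+_ (~⇒d≡1 pt) (~⇒d≡1 (~-sym qt))) (sym dpq≡2))
      (trans (cong₂ _+_ (~⇒d≡1 qt) tx) (sym qx))
      (trans (cong₂ _+_ (trans (d-sym x t) tx) (~⇒d≡1 (~-sym pt)))
             (trans (+-comm n 1) (trans (sym px) (d-sym p x))))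

  -- Lifting across a pair of parallel edges x ~ y and t ~ w (as produced by
  -- `fiber-edge`): every u on a geodesic from t to x has the neighbour
  -- lift u = median(u, w, y), and lifting is an injective, edge-preserving map
  -- of I(t,x) whose image avoids I(t,x).
  module Lift {x y t w : V} (parallel : Parallel x y t w) (tw : t ~ w) where
    xy : d x y ≡ 1
    xy = proj₁ parallel
    wy : d w y ≡ d t x
    wy = proj₁ (proj₂ parallel)
    wx : d w x ≡ suc (d t x)
    wx = proj₁ (proj₂ (proj₂ parallel))
    ty : d t y ≡ suc (d t x)
    ty = proj₂ (proj₂ (proj₂ parallel))

    -- The gate of u in the interval I(w,y).
    lift : V → V
    lift u = median u w y

    module OnGeodesic {u : V} (tux : Between t u x) where
      p q : ℕ
      p = d u t
      q = d u x

      p+q : p + q ≡ d t x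
      p+q = trans (cong (_+ q) (d-sym u t)) tux

      split₁ : suc (d t x) ≡ suc p + q
      split₁ = cong suc (sym p+q)

      split₂ : suc (d t x) ≡ p + suc q
      split₂ = trans split₁ (sym (+-suc p q))

      u-w : d u w ≡ suc p
      u-w = ≤-antisym (subst (d u w ≤_) (+-comm p 1) (d-≤-via refl (~⇒d≡1 tw)))
                      (subst (suc p ≤_) (d-sym w u) (d-≥-via₁ (trans wx split₁) refl))

      u-y : d u y ≡ suc q
      u-y = ≤-antisym (subst (d u y ≤_) (+-comm q 1) (d-≤-via refl xy))
                      (d-≥-via₂ (trans ty split₂) (d-sym t u))

      solved : d u (lift u) ≡ 1 × d (lift u) w ≡ p × d (lift u) y ≡ q
      solved = three-distances
        (trans (median-between₁ u w y) u-w)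
        (trans (cong (_+ d (lift u) y) (d-sym (lift u) w)) (trans (median-between₂ u w y) (trans wy (sym p+q))))
        (trans (cong₂ _+_ (d-sym (lift u) y) (d-sym u (lift u))) (trans (median-between₃ u w y) (trans (d-sym y u) u-y)))

      u-lift : d u (lift u) ≡ 1
      u-lift = proj₁ solved

      lift-u : d (lift u) u ≡ 1
      lift-u = trans (d-sym (lift u) u) u-lift

      lift-w : d (lift u) w ≡ p
      lift-w = proj₁ (proj₂ solved)

      lift-y : d (lift u) y ≡ q
      lift-y = proj₂ (proj₂ solved)

      lift-x : d (lift u) x ≡ suc q
      lift-x = ≤-antisym (d-≤-via lift-u refl)
                         (d-≥-via₂ (trans wx split₂) (trans (d-sym w (lift u)) lift-w))

      lift-t : d (lift u) t ≡ suc p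
      lift-t = ≤-antisym (d-≤-via lift-u refl)
                         (subst (suc p ≤_) (d-sym t (lift u)) (d-≥-via₁ (trans ty split₁) lift-y))

      recover : u ≡ median (lift u) t x
      recover = median-unique
        (trans (cong (_+ p) lift-u) (sym lift-t))
        tux
        (trans (cong₂ _+_ (d-sym x u) u-lift) (trans (+-comm q 1) (trans (sym lift-x) (d-sym (lift u) x))))

    adjacent-lift : ∀ {u} → Between t u x → u ~ lift u
    adjacent-lift tux = d≡1⇒~ (OnGeodesic.u-lift tux)

    lift-injective : ∀ {u v} → Between t u x → Between t v x → lift u ≡ lift v → u ≡ v
    lift-injective tux tvx eq =
      trans (OnGeodesic.recover tux) (trans (cong (λ m → median m t x) eq) (sym (OnGeodesic.recover tvx)))

    -- On I(t,x) a vertex is nearer to x than to y; for a lift it is the other way round.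
    lift-off : ∀ {u v} → Between t u x → Between t v x → lift u ≢ v
    lift-off {u} tux tvx refl = m≢1+n+m (d u x) {1}
      (trans (sym (OnGeodesic.lift-y tux)) (trans (OnGeodesic.u-y tvx) (cong suc (OnGeodesic.lift-x tux))))

    -- An edge u ~ v of I(t,x) pointing away from t lifts to an edge: the common
    -- neighbour z of v and lift u towards w is lift v.
    lift-edge-outward : ∀ {u v} → Between t u x → Between t v x → u ~ v →
      d v x ≡ suc (d u x) → lift u ~ lift v
    lift-edge-outward {u} {v} tux tvx u~v vx = subst (lift u ~_) z≡lift-v (d≡1⇒~ lift-u-z)
      where
      module At-u = OnGeodesic tux
      module At-v = OnGeodesic tvx
      q p' : ℕ
      q = d u x
      p' = d v t

      tx : d t x ≡ p' + suc q
      tx = trans (sym At-v.p+q) (cong (p' +_) vx)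

      u-t : d u t ≡ suc p'
      u-t = +-cancelʳ-≡ q _ _ (trans At-u.p+q (trans tx (+-suc p' q)))

      v-y : d v y ≡ 2 + q
      v-y = trans At-v.u-y (cong suc vx)

      v-lift-u : d v (lift u) ≡ 2
      v-lift-u = ≤-antisym (d-≤-via (~⇒d≡1 (~-sym u~v)) At-u.u-lift) (d-≥-via₁ v-y At-u.lift-y)

      z : V
      z = median v (lift u) w

      z-lift-u-w : d z (lift u) + d z w ≡ suc p'
      z-lift-u-w = trans (cong (_+ d z w) (d-sym z (lift u)))
                         (trans (median-between₂ v (lift u) w) (trans At-u.lift-w u-t))

      solved : d v z ≡ 1 × d z (lift u) ≡ 1
      solved = two-distances
        (trans (median-between₁ v (lift u) w) v-lift-u)
        z-lift-u-w
        (trans (cong₂ _+_ (d-sym z w) (d-sym v z)) (trans (median-between₃ v (lift u) w) (trans (d-sym w v) At-v.u-w)))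

      v-z : d v z ≡ 1
      v-z = proj₁ solved

      lift-u-z : d (lift u) z ≡ 1
      lift-u-z = trans (d-sym (lift u) z) (proj₂ solved)

      z-w : d z w ≡ p'
      z-w = suc-injective (trans (cong (_+ d z w) (sym (proj₂ solved))) z-lift-u-w)

      z-y : d z y ≡ suc q
      z-y = ≤-antisym (d-≤-via (proj₂ solved) At-u.lift-y)
                      (d-≥-via₂ (trans wy tx) (trans (d-sym w z) z-w))

      z≡lift-v : z ≡ lift v
      z≡lift-v = median-unique
        (trans (cong₂ _+_ v-z z-w) (sym At-v.u-w))
        (trans (cong₂ _+_ (trans (d-sym w z) z-w) z-y) (trans (sym tx) (sym wy)))
        (trans (cong₂ _+_ (trans (d-sym y z) z-y) (trans (d-sym z v) v-z))
               (trans (+-comm (suc q) 1) (trans (sym v-y) (d-sym v y))))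

    lift-edge : ∀ {u v} → Between t u x → Between t v x → u ~ v → lift u ~ lift v
    lift-edge {u} {v} tux tvx u~v with edge-level x u~v
    ... | inj₁ outward = lift-edge-outward tux tvx u~v outward
    ... | inj₂ inward  = ~-sym (lift-edge-outward tvx tux (~-sym u~v) inward)

  boundary-cube-extends : ∀ {H x k} → H x →
    ContainsCubeIn G (TotBdV G H x) (TotBdE G H x) k → ContainsCube G (suc k)
  boundary-cube-extends {H} {x} {k} Hx (f , f-inj , in-boundary , in-edges) = extend (in-boundary top)
    where
    f-edge : ∀ a b → a ⟷ b → f a ~ f b
    f-edge a b e = proj₂ (proj₂ (proj₂ (proj₂ (proj₂ (in-edges a b e)))))

    level : Vec Bool k → ℕ
    level a = d (f a) x

    no-saddle : ∀ {p q r s n} → p ⟷ r → q ⟷ r → p ⟷ s → q ⟷ s → p ≢ q →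
      level p ≡ suc n → level q ≡ suc n → level r ≡ n → level s ≡ n → r ≡ s
    no-saddle pr qr ps qs p≢q p-up q-up r-down s-down = f-inj _ _
      (saddle-collapse x (f-edge _ _ pr) (f-edge _ _ qr) (f-edge _ _ ps) (f-edge _ _ qs)
        (p≢q ∘ f-inj _ _) p-up q-up r-down s-down)

    open GradedCube level (λ a b e → edge-level x (f-edge a b e)) no-saddle

    geodesic : ∀ a → Between (f top) (f a) x
    geodesic a = ≤-antisym
      (≤-trans (+-monoˡ-≤ (level a) near-top)
               (≤-reflexive (trans (+-comm (hamming a top) (level a)) (below-top a))))
      (d-triangle (f top) (f a) x)
      where
      near-top : d (f top) (f a) ≤ hamming a top
      near-top = subst (_≤ hamming a top) (d-sym (f a) (f top)) (d-min (cube-walk f f-edge a top))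

    extend : TotBdV G H x (f top) → ContainsCube G (suc k)
    extend (y , Hy , (x≢y , _) , t∈Fx , w , w∈Fy , t~w) =
      prism G f lift f-inj
        (λ a b eq → f-inj a b (lift-injective (geodesic a) (geodesic b) eq))
        (λ a b → lift-off (geodesic a) (geodesic b))
        f-edge
        (λ a b e → lift-edge (geodesic a) (geodesic b) (f-edge a b e))
        (λ a → adjacent-lift (geodesic a))
      where open Lift (fiber-edge Hx Hy x≢y t∈Fx w∈Fy t~w) t~w

-- Lemma 14: in a median graph of dimension d, the total boundary of every fiber
-- of a gated subgraph contains no d-cube, since such a cube would extend to a
-- (d+1)-cube of G.
lemma14 : (G : Graph) (d : ℕ) → IsMedian G → HasDimension G d →
    (H : Graph.V G → Set) → IsGated G H →
    (x : Graph.V G) → H x →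
    ¬ ContainsCubeIn G (TotBdV G H x) (TotBdE G H x) d
lemma14 G d med (_ , maximal) H _ x Hx boundary-cube =
  1+n≰n (maximal (suc d) (MedianGraph.boundary-cube-extends G med Hx boundary-cube))
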